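{- Let $P$ be a Dyck path of order $n$ and $X=\{1,\dots,n\}$. Define relations $T,R$ on $X$ by: $(i,j)\in T$ iff $i<j$ and $s_{i,j}$ is below $P$; $(i,j)\in R$ iff $i<j$ and $s_{i,j}$ is above $P$. Then $(T,R)$ is a Catalan pair of type 2, and the map $P\mapsto(T,R)$ is a bijection between Dyck paths of order $n$ and isomorphism types of Catalan pairs of type 2 on $n$ elements.
   Context: A Dyck path of order $n$ is a lattice path from $(0,0)$ to $(n,n)$ with $n$ up-steps $(i,j)\to(i,j+1)$ and $n$ right-steps $(i,j)\to(i+1,j)$ such that every point $(i,j)$ on it satisfies $i\le j$. For $(i,j)\in\{1,\dots,n\}^2$, $s_{i,j}$ is the axis-aligned unit square with top-right corner $(i,j)$; it is above $P$ if its interior lies above $P$ (equivalently, the $i$-th right-step of $P$ is preceded by at most $j$ up-steps), and below $P$ otherwise. A Catalan pair of type 2 is a pair $(T,R)$ of relations on a finite set with: $R$ and $T\cup R$ partial orders (irreflexive, transitive); any two distinct elements comparable by exactly one of $T$, $R$; no three distinct $x,y,z$ with $xTy$, $xTz$, $yRz$; no three $x,y,z$ with $yTx$, $zTx$, $yRz$. Isomorphism of pairs of relations means a bijection preserving both relations in both directions. -}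

module Defs where

open import Data.Nat using (ℕ; zero; suc; _≤_; _<_)
open import Data.List using (List; []; _∷_; take; length)
open import Data.Fin using (Fin; toℕ)
open import Data.Product using (Σ; _×_; ∃; ∃-syntax)
open import Data.Sum using (_⊎_)
open import Relation.Nullary using (¬_)
open import Relation.Binary.PropositionalEquality using (_≡_; _≢_)
open import Function.Bundles using (Bijection; _⤖_; _⇔_)

-- U = up-step (i,j) → (i,j+1);  Rt = right-step (i,j) → (i+1,j)
data Step : Set where
  U Rt : Step

countU : List Step → ℕ
countU []        = 0
countU (U  ∷ s)  = suc (countU s)
countU (Rt ∷ s)  = countU s

countR : List Step → ℕ
countR []        = 0
countR (U  ∷ s)  = countR s
countR (Rt ∷ s)  = suc (countR s)

-- A step list is a Dyck path of order n: n up-steps, n right-steps,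
-- and every point (i,j) visited (i = #right-steps so far, j = #up-steps
-- so far, i.e. the endpoint of every prefix) satisfies i ≤ j.
record IsDyck (n : ℕ) (s : List Step) : Set where
  field
    ups    : countU s ≡ n
    rights : countR s ≡ n
    prefix : ∀ k → countR (take k s) ≤ countU (take k s)

DyckPath : ℕ → Set
DyckPath n = Σ (List Step) (IsDyck n)

-- upsBefore s i = number of up-steps preceding the i-th right-step (i ≥ 1)
upsBefore : List Step → ℕ → ℕ
upsBefore []             _             = 0
upsBefore (U  ∷ s)       i             = suc (upsBefore s i)
upsBefore (Rt ∷ s)       zero          = 0
upsBefore (Rt ∷ s)       (suc zero)    = 0
upsBefore (Rt ∷ s)       (suc (suc i)) = upsBefore s (suc i)

-- The square s_{i,j} (top-right corner (i,j)) lies above P iff its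
-- interior lies above P, i.e. the i-th right-step of P (at height
-- upsBefore i) lies at height ≤ j-1, i.e. upsBefore i < j.
AboveP : List Step → ℕ → ℕ → Set
AboveP s i j = upsBefore s i < j

BelowP : List Step → ℕ → ℕ → Set
BelowP s i j = ¬ AboveP s i j

-- X = {1,…,n} is represented by Fin n, element x standing for toℕ x + 1.
Rel₂ : ℕ → Set₁
Rel₂ n = Fin n → Fin n → Set

T[_] : ∀ {n} → DyckPath n → Rel₂ n
T[ P ] x y = (toℕ x < toℕ y) × BelowP (Σ.proj₁ P) (suc (toℕ x)) (suc (toℕ y))

R[_] : ∀ {n} → DyckPath n → Rel₂ n
R[ P ] x y = (toℕ x < toℕ y) × AboveP (Σ.proj₁ P) (suc (toℕ x)) (suc (toℕ y))

Irreflexive : ∀ {n} → Rel₂ n → Set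
Irreflexive r = ∀ x → ¬ r x x

Transitive : ∀ {n} → Rel₂ n → Set
Transitive r = ∀ x y z → r x y → r y z → r x z

StrictPO : ∀ {n} → Rel₂ n → Set
StrictPO r = Irreflexive r × Transitive r

_∪_ : ∀ {n} → Rel₂ n → Rel₂ n → Rel₂ n
(r ∪ r') x y = r x y ⊎ r' x y

Comparable : ∀ {n} → Rel₂ n → Fin n → Fin n → Set
Comparable r x y = r x y ⊎ r y x

record IsCatalanPair2 {n : ℕ} (T R : Rel₂ n) : Set where
  field
    R-po   : StrictPO R
    TR-po  : StrictPO (T ∪ R)
    compar : ∀ x y → x ≢ y → Comparable T x y ⊎ Comparable R x y
    unique : ∀ x y → x ≢ y → ¬ (Comparable T x y × Comparable R x y)
    forbid₁ : ∀ x y z → x ≢ y → x ≢ z → y ≢ z →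
              ¬ (T x y × T x z × R y z)
    forbid₂ : ∀ x y z → ¬ (T y x × T z x × R y z)

record PairIso {n : ℕ} (T R T' R' : Rel₂ n) : Set where
  field
    f    : Fin n ⤖ Fin n
  open Bijection f renaming (to to φ)
  field
    pres-T : ∀ x y → T x y ⇔ T' (φ x) (φ y)
    pres-R : ∀ x y → R x y ⇔ R' (φ x) (φ y)

-- A Dyck path is determined by its heights h(i), the number of up-steps before its i-th
-- right-step, and these range exactly over the weakly increasing sequences with
-- i ≤ h(i) ≤ n. For i < j, i T j holds iff j ≤ h(i) and i R j iff h(i) < j, so T ∪ R is the
-- usual order and any weakly increasing h gives a Catalan pair of type 2. An isomorphism of
-- two such pairs preserves T ∪ R, so it is the identity; then the T-successors of each i,
-- and hence the heights and the paths, agree. Conversely, in a Catalan pair of type 2 the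
-- order T ∪ R is total; relabel along it. The forbidden patterns then say that the
-- T-successors of each i form an interval i < j ≤ h(i) and that h is weakly increasing,
-- so h is the height sequence of a Dyck path whose pair is the given one.
module Submission where

open import Defs
open import Data.Bool.Properties using (T-≡)
open import Data.Empty using (⊥-elim)
open import Data.Fin as Fin using (Fin; toℕ; fromℕ; fromℕ<; inject₁; punchOut)
  renaming (zero to fzero; suc to fsuc)
open import Data.Fin.Properties as Finₚ
  using (toℕ-injective; toℕ-fromℕ; toℕ-fromℕ<; toℕ-inject₁; any?; punchOut-injective; injective⇒≤)
  renaming (_≟_ to _≟ᶠ_)
open import Data.Fin.Subset using (Subset; _∈_; _⊂_; ∣_∣; ⊤)
open import Data.Fin.Subset.Properties using (p⊂q⇒∣p∣<∣q∣; ∣⊤∣≡n; ∈⊤; ⊆⊤)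
open import Data.List using (List; []; _∷_; take; replicate; _++_)
open import Data.Nat using (ℕ; zero; suc; _≤_; _<_; _+_; _∸_; z≤n; s≤s; s≤s⁻¹; _<?_; _≤?_)
open import Data.Nat.Properties
open import Data.Product using (Σ; _×_; _,_; ∃; proj₁; proj₂; map₂)
open import Data.Sum using (_⊎_; inj₁; inj₂)
open import Data.Vec using (tabulate)
open import Data.Vec.Properties using (lookup∘tabulate; []=⇒lookup; lookup⇒[]=)
open import Function using (_∘_)
open import Function.Bundles using (Bijection; _⤖_; mk⤖; _⇔_; mk⇔; Equivalence)
open import Function.Construct.Composition using (_⇔-∘_)
open import Function.Construct.Symmetry using (⇔-sym)
open import Function.Definitions using (Injective)
open import Relation.Binary.Definitions using (Monotonic₁; tri<; tri≈; tri>)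
open import Relation.Binary.PropositionalEquality
open import Relation.Nullary using (Dec; yes; no; ¬_)
open import Relation.Nullary.Decidable using (⌊_⌋; toWitness; fromWitness; _⊎-dec_)
open import Relation.Unary using (Decidable)

open Equivalence using (to; from)

countU-replicate : ∀ a s → countU (replicate a U ++ s) ≡ a + countU s
countU-replicate zero    s = refl
countU-replicate (suc a) s = cong suc (countU-replicate a s)

countR-replicate : ∀ a s → countR (replicate a U ++ s) ≡ countR s
countR-replicate zero    s = refl
countR-replicate (suc a) s = countR-replicate a s

upsBefore-replicate : ∀ a s i → upsBefore (replicate a U ++ s) i ≡ a + upsBefore s i
upsBefore-replicate zero    s i = refl
upsBefore-replicate (suc a) s i = cong suc (upsBefore-replicate a s i)

upsBefore≤countU : ∀ s i → upsBefore s i ≤ countU s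
upsBefore≤countU []       i             = z≤n
upsBefore≤countU (U  ∷ s) i             = s≤s (upsBefore≤countU s i)
upsBefore≤countU (Rt ∷ s) zero          = z≤n
upsBefore≤countU (Rt ∷ s) (suc zero)    = z≤n
upsBefore≤countU (Rt ∷ s) (suc (suc i)) = upsBefore≤countU s (suc i)

upsBefore-mono : ∀ s {i j} → i ≤ j → upsBefore s (suc i) ≤ upsBefore s (suc j)
upsBefore-mono []       _         = z≤n
upsBefore-mono (U  ∷ s) i≤j       = s≤s (upsBefore-mono s i≤j)
upsBefore-mono (Rt ∷ s) z≤n       = z≤n
upsBefore-mono (Rt ∷ s) (s≤s i≤j) = upsBefore-mono s i≤j

upsBefore-ext : ∀ s s' → countR s ≡ countR s' → countU s ≡ countU s' →
  (∀ i → i < countR s → upsBefore s (suc i) ≡ upsBefore s' (suc i)) → s ≡ s'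
upsBefore-ext []       []        _  _  _  = refl
upsBefore-ext []       (U  ∷ _)  _  () _
upsBefore-ext []       (Rt ∷ _)  () _  _
upsBefore-ext (U  ∷ _) []        _  () _
upsBefore-ext (Rt ∷ _) []        () _  _
upsBefore-ext (U ∷ s)  (U ∷ s')  r  u  e =
  cong (U ∷_) (upsBefore-ext s s' r (suc-injective u) (λ i i< → suc-injective (e i i<)))
upsBefore-ext (Rt ∷ s) (Rt ∷ s') r  u  e =
  cong (Rt ∷_) (upsBefore-ext s s' (suc-injective r) u (λ i i< → e (suc i) (s≤s i<)))
upsBefore-ext (U ∷ s)  (Rt ∷ s') r  u  e with e 0 (subst (0 <_) (sym r) (s≤s z≤n))
... | ()
upsBefore-ext (Rt ∷ s) (U ∷ s')  r  u  e with e 0 (s≤s z≤n)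
... | ()

-- The Dyck condition relaxed by an offset c, in terms of prefixes and in terms of heights.
PrefixBound : ℕ → List Step → Set
PrefixBound c s = ∀ k → countR (take k s) ≤ c + countU (take k s)

HeightBound : ℕ → List Step → Set
HeightBound c s = ∀ i → i < countR s → suc i ≤ c + upsBefore s (suc i)

prefixBound⇒heightBound : ∀ c s → PrefixBound c s → HeightBound c s
prefixBound⇒heightBound c []       pb i       ()
prefixBound⇒heightBound c (U ∷ s)  pb i       i< =
  subst (suc i ≤_) (sym (+-suc c _))
    (prefixBound⇒heightBound (suc c) s (λ k → subst (countR (take k s) ≤_) (+-suc c _) (pb (suc k))) i i<)
prefixBound⇒heightBound c (Rt ∷ s) pb zero    i< = pb 1
prefixBound⇒heightBound zero (Rt ∷ s) pb (suc i) i< with pb 1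
... | ()
prefixBound⇒heightBound (suc c) (Rt ∷ s) pb (suc i) (s≤s i<) =
  s≤s (prefixBound⇒heightBound c s (λ k → s≤s⁻¹ (pb (suc k))) i i<)

heightBound⇒prefixBound : ∀ c s → HeightBound c s → PrefixBound c s
heightBound⇒prefixBound c s       hb zero    = z≤n
heightBound⇒prefixBound c []      hb (suc k) = z≤n
heightBound⇒prefixBound c (U ∷ s) hb (suc k) =
  subst (countR (take k s) ≤_) (sym (+-suc c _))
    (heightBound⇒prefixBound (suc c) s (λ i i< → subst (suc i ≤_) (+-suc c _) (hb i i<)) k)
heightBound⇒prefixBound zero (Rt ∷ s) hb (suc k) with hb 0 (s≤s z≤n)
... | ()
heightBound⇒prefixBound (suc c) (Rt ∷ s) hb (suc k) =
  s≤s (heightBound⇒prefixBound c s (λ i i< → s≤s⁻¹ (hb (suc i) (s≤s i<))) k)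

∀-fromℕ< : ∀ {n} {Q : ℕ → Set} → (∀ (i : Fin n) → Q (toℕ i)) → ∀ i → i < n → Q i
∀-fromℕ< {Q = Q} q i i<n = subst Q (toℕ-fromℕ< i<n) (q (fromℕ< i<n))

height : ∀ {n} → DyckPath n → Fin n → ℕ
height P i = upsBefore (proj₁ P) (suc (toℕ i))

height-mono : ∀ {n} (P : DyckPath n) → Monotonic₁ Fin._≤_ _≤_ (height P)
height-mono P = upsBefore-mono (proj₁ P)

height-lower : ∀ {n} (P : DyckPath n) i → suc (toℕ i) ≤ height P i
height-lower (s , d) i =
  prefixBound⇒heightBound 0 s (IsDyck.prefix d) (toℕ i)
    (subst (toℕ i <_) (sym (IsDyck.rights d)) (Finₚ.toℕ<n i))

height-upper : ∀ {n} (P : DyckPath n) i → height P i ≤ n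
height-upper (s , d) i = subst (upsBefore s (suc (toℕ i)) ≤_) (IsDyck.ups d) (upsBefore≤countU s (suc (toℕ i)))

height-ext : ∀ {n} (P Q : DyckPath n) → (∀ i → height P i ≡ height Q i) → proj₁ P ≡ proj₁ Q
height-ext (s , d) (s' , d') eq = upsBefore-ext s s'
  (trans (IsDyck.rights d) (sym (IsDyck.rights d')))
  (trans (IsDyck.ups d) (sym (IsDyck.ups d')))
  (λ i i< → ∀-fromℕ< eq i (subst (i <_) (IsDyck.rights d) i<))

staircase : ∀ m → ℕ → (Fin m → ℕ) → List Step
staircase zero    c g = []
staircase (suc m) c g = replicate (g fzero ∸ c) U ++ Rt ∷ staircase m (g fzero) (g ∘ fsuc)

m+[[n∸m]+k]≡n+k : ∀ {m n} k → m ≤ n → m + ((n ∸ m) + k) ≡ n + k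
m+[[n∸m]+k]≡n+k {m} k m≤n = trans (sym (+-assoc m _ k)) (cong (_+ k) (m+[n∸m]≡n m≤n))

countR-staircase : ∀ m c g → countR (staircase m c g) ≡ m
countR-staircase zero    c g = refl
countR-staircase (suc m) c g =
  trans (countR-replicate (g fzero ∸ c) _) (cong suc (countR-staircase m (g fzero) (g ∘ fsuc)))

upsBefore-staircase : ∀ m c (g : Fin m → ℕ) → Monotonic₁ Fin._≤_ _≤_ g → (∀ i → c ≤ g i) →
  ∀ i → c + upsBefore (staircase m c g) (suc (toℕ i)) ≡ g i
upsBefore-staircase (suc m) c g mono c≤g fzero = begin
  c + upsBefore (replicate (g fzero ∸ c) U ++ Rt ∷ _) 1 ≡⟨ cong (c +_) (upsBefore-replicate (g fzero ∸ c) _ 1) ⟩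
  c + ((g fzero ∸ c) + 0)                             ≡⟨ m+[[n∸m]+k]≡n+k 0 (c≤g fzero) ⟩
  g fzero + 0                                         ≡⟨ +-identityʳ _ ⟩
  g fzero                                             ∎
  where open ≡-Reasoning
upsBefore-staircase (suc m) c g mono c≤g (fsuc i) = begin
  c + upsBefore (replicate (g fzero ∸ c) U ++ Rt ∷ rest) (suc (suc (toℕ i)))
    ≡⟨ cong (c +_) (upsBefore-replicate (g fzero ∸ c) _ (suc (suc (toℕ i)))) ⟩
  c + ((g fzero ∸ c) + upsBefore rest (suc (toℕ i)))
    ≡⟨ m+[[n∸m]+k]≡n+k _ (c≤g fzero) ⟩
  g fzero + upsBefore rest (suc (toℕ i))
    ≡⟨ upsBefore-staircase m (g fzero) (g ∘ fsuc) (λ i≤j → mono (s≤s i≤j)) (λ _ → mono z≤n) i ⟩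
  g (fsuc i) ∎
  where
  open ≡-Reasoning
  rest = staircase m (g fzero) (g ∘ fsuc)

countU-staircase-step : ∀ m c (g : Fin (suc m) → ℕ) → c ≤ g fzero →
  c + countU (staircase (suc m) c g) ≡ g fzero + countU (staircase m (g fzero) (g ∘ fsuc))
countU-staircase-step m c g c≤g₀ = begin
  c + countU (replicate (g fzero ∸ c) U ++ Rt ∷ rest) ≡⟨ cong (c +_) (countU-replicate (g fzero ∸ c) _) ⟩
  c + ((g fzero ∸ c) + countU rest)                   ≡⟨ m+[[n∸m]+k]≡n+k _ c≤g₀ ⟩
  g fzero + countU rest                               ∎
  where
  open ≡-Reasoning
  rest = staircase m (g fzero) (g ∘ fsuc)

countU-staircase : ∀ m c (g : Fin (suc m) → ℕ) → Monotonic₁ Fin._≤_ _≤_ g → (∀ i → c ≤ g i) →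
  c + countU (staircase (suc m) c g) ≡ g (fromℕ m)
countU-staircase zero    c g mono c≤g = trans (countU-staircase-step 0 c g (c≤g fzero)) (+-identityʳ _)
countU-staircase (suc m) c g mono c≤g = trans (countU-staircase-step (suc m) c g (c≤g fzero))
  (countU-staircase m (g fzero) (g ∘ fsuc) (λ i≤j → mono (s≤s i≤j)) (λ _ → mono z≤n))

countU-staircase≡n : ∀ n (h : Fin n → ℕ) → Monotonic₁ Fin._≤_ _≤_ h →
  (∀ i → suc (toℕ i) ≤ h i) → (∀ i → h i ≤ n) → countU (staircase n 0 h) ≡ n
countU-staircase≡n zero    h mono lower upper = refl
countU-staircase≡n (suc m) h mono lower upper = trans (countU-staircase m 0 h mono (λ _ → z≤n))
  (≤-antisym (upper (fromℕ m)) (subst (λ k → suc k ≤ h (fromℕ m)) (toℕ-fromℕ m) (lower (fromℕ m))))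

heights⇒DyckPath : ∀ {n} (h : Fin n → ℕ) → Monotonic₁ Fin._≤_ _≤_ h →
  (∀ i → suc (toℕ i) ≤ h i) → (∀ i → h i ≤ n) →
  Σ (DyckPath n) λ P → ∀ i → height P i ≡ h i
heights⇒DyckPath {n} h mono lower upper = (s , isDyck) , heights
  where
  s = staircase n 0 h
  heights : ∀ i → upsBefore s (suc (toℕ i)) ≡ h i
  heights = upsBefore-staircase n 0 h mono (λ _ → z≤n)
  isDyck : IsDyck n s
  isDyck = record
    { ups    = countU-staircase≡n n h mono lower upper
    ; rights = countR-staircase n 0 h
    ; prefix = heightBound⇒prefixBound 0 s λ i i< →
        ∀-fromℕ< (λ j → subst (suc (toℕ j) ≤_) (sym (heights j)) (lower j)) i
          (subst (i <_) (countR-staircase n 0 h) i<)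
    }

-- T[ P ] and R[ P ] are, definitionally, HeightT (height P) and HeightR (height P).
HeightT HeightR : ∀ {n} → (Fin n → ℕ) → Rel₂ n
HeightT h x y = toℕ x < toℕ y × ¬ (h x < suc (toℕ y))
HeightR h x y = toℕ x < toℕ y × h x < suc (toℕ y)

<⇒HeightT⊎HeightR : ∀ {n} (h : Fin n → ℕ) {x y} → toℕ x < toℕ y → HeightT h x y ⊎ HeightR h x y
<⇒HeightT⊎HeightR h {x} {y} x<y with h x <? suc (toℕ y)
... | yes below = inj₂ (x<y , below)
... | no ¬below = inj₁ (x<y , ¬below)

HeightT-≗ : ∀ {n} {h h' : Fin n → ℕ} → (∀ i → h i ≡ h' i) → ∀ x y → HeightT h x y ⇔ HeightT h' x y
HeightT-≗ eq x y = mk⇔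
  (map₂ (subst (λ a → ¬ (a < suc (toℕ y))) (eq x)))
  (map₂ (subst (λ a → ¬ (a < suc (toℕ y))) (sym (eq x))))

HeightR-≗ : ∀ {n} {h h' : Fin n → ℕ} → (∀ i → h i ≡ h' i) → ∀ x y → HeightR h x y ⇔ HeightR h' x y
HeightR-≗ eq x y = mk⇔
  (map₂ (subst (_< suc (toℕ y)) (eq x)))
  (map₂ (subst (_< suc (toℕ y)) (sym (eq x))))

heightPair-isCatalanPair2 : ∀ {n} {h : Fin n → ℕ} → Monotonic₁ Fin._≤_ _≤_ h →
  IsCatalanPair2 (HeightT h) (HeightR h)
heightPair-isCatalanPair2 {h = h} mono = record
  { R-po    = (λ x xRx → <-irrefl refl (proj₁ xRx))
            , (λ x y z (x<y , hx≤y) (y<z , _) → <-trans x<y y<z , <-trans hx≤y (s≤s y<z))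
  ; TR-po   = (λ x x<x → <-irrefl refl (ordered x<x))
            , (λ x y z xy yz → <⇒HeightT⊎HeightR h (<-trans (ordered xy) (ordered yz)))
  ; compar  = comparable
  ; unique  = unique
  ; forbid₁ = λ x y z _ _ _ ((x<y , _) , (_ , xz∉R) , (_ , hy≤z)) →
                xz∉R (≤-<-trans (mono (<⇒≤ x<y)) hy≤z)
  ; forbid₂ = λ x y z ((_ , yx∉R) , (z<x , _) , (_ , hy≤z)) → yx∉R (<-trans hy≤z (s≤s z<x))
  }
  where
  ordered : ∀ {x y} → (HeightT h ∪ HeightR h) x y → toℕ x < toℕ y
  ordered (inj₁ (x<y , _)) = x<y
  ordered (inj₂ (x<y , _)) = x<y
  comparable : ∀ x y → x ≢ y → Comparable (HeightT h) x y ⊎ Comparable (HeightR h) x y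
  comparable x y x≢y with <-cmp (toℕ x) (toℕ y)
  ... | tri< x<y _ _ with <⇒HeightT⊎HeightR h x<y
  ...   | inj₁ t = inj₁ (inj₁ t)
  ...   | inj₂ r = inj₂ (inj₁ r)
  comparable x y x≢y | tri≈ _ x≡y _ = ⊥-elim (x≢y (toℕ-injective x≡y))
  comparable x y x≢y | tri> _ _ y<x with <⇒HeightT⊎HeightR h y<x
  ...   | inj₁ t = inj₁ (inj₂ t)
  ...   | inj₂ r = inj₂ (inj₂ r)
  unique : ∀ x y → x ≢ y → ¬ (Comparable (HeightT h) x y × Comparable (HeightR h) x y)
  unique x y _ (inj₁ (_ , xy∉R) , inj₁ (_ , xy∈R)) = xy∉R xy∈R
  unique x y _ (inj₁ (x<y , _)  , inj₂ (y<x , _))  = <-asym x<y y<x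
  unique x y _ (inj₂ (y<x , _)  , inj₁ (x<y , _))  = <-asym x<y y<x
  unique x y _ (inj₂ (_ , yx∉R) , inj₂ (_ , yx∈R)) = yx∉R yx∈R

strictMono⇒toℕ≤ : ∀ {m} (f : Fin m → ℕ) → Monotonic₁ Fin._<_ _<_ f → ∀ i → toℕ i ≤ f i
strictMono⇒toℕ≤ f mono fzero    = z≤n
strictMono⇒toℕ≤ f mono (fsuc i) =
  ≤-<-trans (strictMono⇒toℕ≤ (f ∘ inject₁) mono-inject₁ i) (mono (s≤s (≤-reflexive (toℕ-inject₁ i))))
  where
  mono-inject₁ : Monotonic₁ Fin._<_ _<_ (f ∘ inject₁)
  mono-inject₁ {x} {y} x<y = mono (subst₂ _<_ (sym (toℕ-inject₁ x)) (sym (toℕ-inject₁ y)) x<y)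

strictMono-bijection⇒id : ∀ {n} (f : Fin n ⤖ Fin n) → Monotonic₁ Fin._<_ Fin._<_ (Bijection.to f) →
  ∀ i → Bijection.to f i ≡ i
strictMono-bijection⇒id {n} f mono i =
  toℕ-injective (≤-antisym φi≤i (strictMono⇒toℕ≤ (toℕ ∘ φ) mono i))
  where
  φ = Bijection.to f
  ψ : Fin n → Fin n
  ψ y = proj₁ (Bijection.strictlySurjective f y)
  φ∘ψ : ∀ y → φ (ψ y) ≡ y
  φ∘ψ y = proj₂ (Bijection.strictlySurjective f y)
  ψ-mono : Monotonic₁ Fin._<_ _<_ (toℕ ∘ ψ)
  ψ-mono {x} {y} x<y with Finₚ.<-cmp (ψ x) (ψ y)
  ... | tri< ψx<ψy _ _ = ψx<ψy
  ... | tri≈ _ ψx≡ψy _ = ⊥-elim (Finₚ.<⇒≢ x<y (trans (sym (φ∘ψ x)) (trans (cong φ ψx≡ψy) (φ∘ψ y))))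
  ... | tri> _ _ ψy<ψx = ⊥-elim (<-asym x<y (subst₂ Fin._<_ (φ∘ψ y) (φ∘ψ x) (mono ψy<ψx)))
  φi≤i : toℕ (φ i) ≤ toℕ i
  φi≤i = subst (λ j → toℕ (φ i) ≤ toℕ j) (Bijection.injective f (φ∘ψ (φ i))) (strictMono⇒toℕ≤ (toℕ ∘ ψ) ψ-mono (φ i))

-- If h i < h' i, the element at position h i is a T_{h'}- but not a T_h-successor of i.
HeightT⊆HeightT⇒≤ : ∀ {n} {h h' : Fin n → ℕ} → (∀ i → suc (toℕ i) ≤ h i) → (∀ i → h' i ≤ n) →
  (∀ i j → HeightT h' i j → HeightT h i j) → ∀ i → h' i ≤ h i
HeightT⊆HeightT⇒≤ {h = h} {h'} lower upper' T'⊆T i = ≮⇒≥ λ hi<h'i →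
  let j   = fromℕ< (<-≤-trans hi<h'i (upper' i))
      j≡h = toℕ-fromℕ< (<-≤-trans hi<h'i (upper' i))
      i<j = subst (toℕ i <_) (sym j≡h) (lower i)
      ij∈T' = i<j , λ h'i<1+j → <⇒≱ hi<h'i (s≤s⁻¹ (subst (λ k → h' i < suc k) j≡h h'i<1+j))
  in proj₂ (T'⊆T i j ij∈T') (subst (λ k → h i < suc k) (sym j≡h) (n<1+n (h i)))

heightPairIso⇒≗ : ∀ {n} {h h' : Fin n → ℕ} →
  (∀ i → suc (toℕ i) ≤ h i) → (∀ i → h i ≤ n) → (∀ i → suc (toℕ i) ≤ h' i) → (∀ i → h' i ≤ n) →
  PairIso (HeightT h) (HeightR h) (HeightT h') (HeightR h') → ∀ i → h i ≡ h' i
heightPairIso⇒≗ {h = h} {h'} lower upper lower' upper' iso i =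
  ≤-antisym (HeightT⊆HeightT⇒≤ lower' upper T⊆T' i) (HeightT⊆HeightT⇒≤ lower upper' T'⊆T i)
  where
  open PairIso iso using (f; pres-T; pres-R)
  φ = Bijection.to f
  φ-mono : Monotonic₁ Fin._<_ Fin._<_ φ
  φ-mono {x} {y} x<y with <⇒HeightT⊎HeightR h x<y
  ... | inj₁ t = proj₁ (to (pres-T x y) t)
  ... | inj₂ r = proj₁ (to (pres-R x y) r)
  φ≗id : ∀ i → φ i ≡ i
  φ≗id = strictMono-bijection⇒id f φ-mono
  T⊆T' : ∀ i j → HeightT h i j → HeightT h' i j
  T⊆T' i j t = subst₂ (HeightT h') (φ≗id i) (φ≗id j) (to (pres-T i j) t)
  T'⊆T : ∀ i j → HeightT h' i j → HeightT h i j
  T'⊆T i j t = from (pres-T i j) (subst₂ (HeightT h') (sym (φ≗id i)) (sym (φ≗id j)) t)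

injective⇒surjective : ∀ {m} (f : Fin m → Fin m) → Injective _≡_ _≡_ f → ∀ y → ∃ λ x → f x ≡ y
injective⇒surjective f inj y with any? (λ x → f x ≟ᶠ y)
... | yes hit = hit
injective⇒surjective {suc m} f inj y | no miss = ⊥-elim (<-irrefl refl (injective⇒≤ g-injective))
  where
  g : Fin (suc m) → Fin m
  g x = punchOut {i = y} (λ y≡fx → miss (x , sym y≡fx))
  g-injective : Injective _≡_ _≡_ g
  g-injective = inj ∘ punchOut-injective {i = y} _ _

downClosed⇒initialSegment : ∀ {n} {P : Fin n → Set} → Decidable P →
  (∀ {j k} → toℕ k ≤ toℕ j → P j → P k) → ∃ λ h → h ≤ n × (∀ j → P j ⇔ toℕ j < h)
downClosed⇒initialSegment {zero} P? closed = 0 , z≤n , λ ()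
downClosed⇒initialSegment {suc n} P? closed with P? fzero
... | no ¬P₀ = 0 , z≤n , λ j → mk⇔ (λ Pj → ⊥-elim (¬P₀ (closed z≤n Pj))) (λ ())
... | yes P₀ with downClosed⇒initialSegment (P? ∘ fsuc) (λ k≤j → closed (s≤s k≤j))
...   | h , h≤n , P⇔ = suc h , s≤s h≤n , λ
  { fzero    → mk⇔ (λ _ → s≤s z≤n) (λ _ → P₀)
  ; (fsuc j) → mk⇔ (s≤s ∘ to (P⇔ j)) (from (P⇔ j) ∘ s≤s⁻¹)
  }

select : ∀ {n} {P : Fin n → Set} → Decidable P → Subset n
select P? = tabulate (⌊_⌋ ∘ P?)

∈-select : ∀ {n} {P : Fin n → Set} (P? : Decidable P) x → x ∈ select P? ⇔ P x
∈-select P? x = mk⇔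
  (λ x∈ → toWitness (from T-≡ (trans (sym (lookup∘tabulate (⌊_⌋ ∘ P?) x)) ([]=⇒lookup x∈))))
  (λ Px → lookup⇒[]= x _ (trans (lookup∘tabulate (⌊_⌋ ∘ P?) x) (to T-≡ (fromWitness Px))))

module Ranking {n} (O : Rel₂ n) (O-po : StrictPO O) (O-total : ∀ x y → x ≢ y → O x y ⊎ O y x) where

  private
    O-irrefl = proj₁ O-po
    O-trans  = proj₂ O-po

  O? : ∀ x y → Dec (O x y)
  O? x y with x ≟ᶠ y
  ... | yes refl = no (O-irrefl x)
  ... | no x≢y with O-total x y x≢y
  ...   | inj₁ xOy = yes xOy
  ...   | inj₂ yOx = no (λ xOy → O-irrefl x (O-trans x y x xOy yOx))

  predecessors : Fin n → Subset n
  predecessors x = select (λ y → O? y x)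

  predecessors-⊂ : ∀ {x y} → O x y → predecessors x ⊂ predecessors y
  predecessors-⊂ {x} {y} xOy =
      (λ {z} z∈ → from (∈-select _ z) (O-trans z x y (to (∈-select _ z) z∈) xOy))
    , x , from (∈-select _ x) xOy , O-irrefl x ∘ to (∈-select _ x)

  ∣predecessors∣<n : ∀ x → ∣ predecessors x ∣ < n
  ∣predecessors∣<n x = subst (∣ predecessors x ∣ <_) (∣⊤∣≡n n)
    (p⊂q⇒∣p∣<∣q∣ (⊆⊤ , x , ∈⊤ , O-irrefl x ∘ to (∈-select _ x)))

  rank : Fin n → Fin n
  rank x = fromℕ< (∣predecessors∣<n x)

  rank-strictMono : ∀ {x y} → O x y → toℕ (rank x) < toℕ (rank y)
  rank-strictMono {x} {y} xOy = subst₂ _<_ (sym (toℕ-fromℕ< (∣predecessors∣<n x)))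
    (sym (toℕ-fromℕ< (∣predecessors∣<n y))) (p⊂q⇒∣p∣<∣q∣ (predecessors-⊂ xOy))

  rank-injective : Injective _≡_ _≡_ rank
  rank-injective {x} {y} rx≡ry with x ≟ᶠ y
  ... | yes x≡y = x≡y
  ... | no x≢y with O-total x y x≢y
  ...   | inj₁ xOy = ⊥-elim (<-irrefl (cong toℕ rx≡ry) (rank-strictMono xOy))
  ...   | inj₂ yOx = ⊥-elim (<-irrefl (cong toℕ (sym rx≡ry)) (rank-strictMono yOx))

  unrank : Fin n → Fin n
  unrank i = proj₁ (injective⇒surjective rank rank-injective i)

  rank∘unrank : ∀ i → rank (unrank i) ≡ i
  rank∘unrank i = proj₂ (injective⇒surjective rank rank-injective i)

  unrank-injective : Injective _≡_ _≡_ unrank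
  unrank-injective {i} {j} eq = trans (sym (rank∘unrank i)) (trans (cong rank eq) (rank∘unrank j))

  unrank-bijection : Fin n ⤖ Fin n
  unrank-bijection = mk⤖
    (unrank-injective , λ x → rank x , λ z≡rx → rank-injective (trans (rank∘unrank _) z≡rx))

  O-unrank⇒< : ∀ {i j} → O (unrank i) (unrank j) → toℕ i < toℕ j
  O-unrank⇒< {i} {j} o = subst₂ (λ a b → toℕ a < toℕ b) (rank∘unrank i) (rank∘unrank j) (rank-strictMono o)

  O-unrank⇔< : ∀ i j → O (unrank i) (unrank j) ⇔ toℕ i < toℕ j
  O-unrank⇔< i j = mk⇔ O-unrank⇒< <⇒O-unrank
    where
    <⇒O-unrank : toℕ i < toℕ j → O (unrank i) (unrank j)
    <⇒O-unrank i<j with O-total (unrank i) (unrank j) (λ eq → <-irrefl (cong toℕ (unrank-injective eq)) i<j)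
    ... | inj₁ o = o
    ... | inj₂ o = ⊥-elim (<-asym i<j (O-unrank⇒< o))

module FromCatalanPair {n} (T R : Rel₂ n) (cp : IsCatalanPair2 T R) where
  open IsCatalanPair2 cp

  total : ∀ x y → x ≢ y → (T ∪ R) x y ⊎ (T ∪ R) y x
  total x y x≢y with compar x y x≢y
  ... | inj₁ (inj₁ t) = inj₁ (inj₁ t)
  ... | inj₁ (inj₂ t) = inj₂ (inj₁ t)
  ... | inj₂ (inj₁ r) = inj₁ (inj₂ r)
  ... | inj₂ (inj₂ r) = inj₂ (inj₂ r)

  open Ranking (T ∪ R) TR-po total using (unrank; unrank-injective; unrank-bijection; O-unrank⇔<)

  T' R' : Rel₂ n
  T' i j = T (unrank i) (unrank j)
  R' i j = R (unrank i) (unrank j)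

  T'⇒< : ∀ {i j} → T' i j → toℕ i < toℕ j
  T'⇒< {i} {j} t = to (O-unrank⇔< i j) (inj₁ t)

  R'⇒< : ∀ {i j} → R' i j → toℕ i < toℕ j
  R'⇒< {i} {j} r = to (O-unrank⇔< i j) (inj₂ r)

  <⇒T'⊎R' : ∀ {i j} → toℕ i < toℕ j → T' i j ⊎ R' i j
  <⇒T'⊎R' {i} {j} = from (O-unrank⇔< i j)

  unrank-≢ : ∀ {i j} → toℕ i < toℕ j → unrank i ≢ unrank j
  unrank-≢ i<j eq = <-irrefl (cong toℕ (unrank-injective eq)) i<j

  ¬T'∧R' : ∀ {i j} → T' i j → ¬ R' i j
  ¬T'∧R' t r = unique _ _ (unrank-≢ (T'⇒< t)) (inj₁ t , inj₁ r)

  <∧¬T'⇒R' : ∀ {i j} → toℕ i < toℕ j → ¬ T' i j → R' i j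
  <∧¬T'⇒R' i<j ¬t with <⇒T'⊎R' i<j
  ... | inj₁ t = ⊥-elim (¬t t)
  ... | inj₂ r = r

  T'? : ∀ i j → Dec (T' i j)
  T'? i j with toℕ i <? toℕ j
  ... | no  i≮j = no (i≮j ∘ T'⇒<)
  ... | yes i<j with <⇒T'⊎R' i<j
  ...   | inj₁ t = yes t
  ...   | inj₂ r = no (λ t → ¬T'∧R' t r)

  T'-interval : ∀ {i j k} → T' i k → toℕ i < toℕ j → toℕ j < toℕ k → T' i j
  T'-interval {i} {j} {k} tik i<j j<k with <⇒T'⊎R' i<j
  ... | inj₁ tij = tij
  ... | inj₂ rij with <⇒T'⊎R' j<k
  ...   | inj₁ tjk = ⊥-elim (forbid₂ (unrank k) (unrank i) (unrank j) (tik , tjk , rij))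
  ...   | inj₂ rjk = ⊥-elim (¬T'∧R' tik (proj₂ R-po _ _ _ rij rjk))

  NotAbove : Fin n → Fin n → Set
  NotAbove i j = toℕ j ≤ toℕ i ⊎ T' i j

  NotAbove-closed : ∀ i {j k} → toℕ k ≤ toℕ j → NotAbove i j → NotAbove i k
  NotAbove-closed i k≤j (inj₁ j≤i) = inj₁ (≤-trans k≤j j≤i)
  NotAbove-closed i {k = k} k≤j (inj₂ tij) with toℕ k ≤? toℕ i | m≤n⇒m<n∨m≡n k≤j
  ... | yes k≤i | _          = inj₁ k≤i
  ... | no  k≰i | inj₁ k<j   = inj₂ (T'-interval tij (≰⇒> k≰i) k<j)
  ... | no  k≰i | inj₂ k≡j   = inj₂ (subst (T' i) (toℕ-injective (sym k≡j)) tij)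

  segment : ∀ i → ∃ λ h → h ≤ n × (∀ j → NotAbove i j ⇔ toℕ j < h)
  segment i = downClosed⇒initialSegment (λ j → (toℕ j ≤? toℕ i) ⊎-dec T'? i j) (NotAbove-closed i)

  h : Fin n → ℕ
  h i = proj₁ (segment i)

  h-upper : ∀ i → h i ≤ n
  h-upper i = proj₁ (proj₂ (segment i))

  NotAbove⇔<h : ∀ i j → NotAbove i j ⇔ toℕ j < h i
  NotAbove⇔<h i = proj₂ (proj₂ (segment i))

  h-lower : ∀ i → suc (toℕ i) ≤ h i
  h-lower i = to (NotAbove⇔<h i i) (inj₁ ≤-refl)

  T'⇒<h : ∀ {i j} → T' i j → toℕ j < h i
  T'⇒<h {i} {j} t = to (NotAbove⇔<h i j) (inj₂ t)

  <h⇒T' : ∀ {i j} → toℕ i < toℕ j → toℕ j < h i → T' i j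
  <h⇒T' {i} {j} i<j j<h with from (NotAbove⇔<h i j) j<h
  ... | inj₁ j≤i = ⊥-elim (<⇒≱ i<j j≤i)
  ... | inj₂ t   = t

  -- If h i' < h i, forbid₁ applies to i, i' and the element at position h i'.
  h-mono : Monotonic₁ Fin._≤_ _≤_ h
  h-mono {i} {i'} i≤i' with m≤n⇒m<n∨m≡n i≤i'
  ... | inj₂ i≡i' = ≤-reflexive (cong h (toℕ-injective i≡i'))
  ... | inj₁ i<i' = ≮⇒≥ λ hi'<hi →
    let j<n  = <-≤-trans hi'<hi (h-upper i)
        j    = fromℕ< j<n
        j≡h  = toℕ-fromℕ< j<n
        i'<j = subst (toℕ i' <_) (sym j≡h) (h-lower i')
        ii'  = <h⇒T' i<i' (<-≤-trans (h-lower i') (<⇒≤ hi'<hi))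
        ij   = <h⇒T' (<-trans i<i' i'<j) (subst (_< h i) (sym j≡h) hi'<hi)
        i'j  = <∧¬T'⇒R' i'<j (<-irrefl j≡h ∘ T'⇒<h)
    in forbid₁ (unrank i) (unrank i') (unrank j)
         (unrank-≢ i<i') (unrank-≢ (<-trans i<i' i'<j)) (unrank-≢ i'<j) (ii' , ij , i'j)

  T'⇔HeightT : ∀ i j → T' i j ⇔ HeightT h i j
  T'⇔HeightT i j = mk⇔
    (λ t → T'⇒< t , λ hi<1+j → <⇒≱ (T'⇒<h t) (s≤s⁻¹ hi<1+j))
    (λ (i<j , hi≮1+j) → <h⇒T' i<j (≮⇒≥ hi≮1+j))

  R'⇔HeightR : ∀ i j → R' i j ⇔ HeightR h i j
  R'⇔HeightR i j = mk⇔
    (λ r → R'⇒< r , ≰⇒> λ 1+j≤hi → ¬T'∧R' (<h⇒T' (R'⇒< r) 1+j≤hi) r)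
    (λ (i<j , hi<1+j) → <∧¬T'⇒R' i<j λ t → proj₂ (to (T'⇔HeightT i j) t) hi<1+j)

  dyckPath : Σ (DyckPath n) λ P → ∀ i → height P i ≡ h i
  dyckPath = heights⇒DyckPath h h-mono h-lower h-upper

  realisation : ∃ λ (P : DyckPath n) → PairIso T[ P ] R[ P ] T R
  realisation = P , record
    { f      = unrank-bijection
    ; pres-T = λ i j → ⇔-sym (T'⇔HeightT i j) ⇔-∘ HeightT-≗ (proj₂ dyckPath) i j
    ; pres-R = λ i j → ⇔-sym (R'⇔HeightR i j) ⇔-∘ HeightR-≗ (proj₂ dyckPath) i j
    }
    where
    P = proj₁ dyckPath

lemma2p8 : (n : ℕ) →
    ((P : DyckPath n) → IsCatalanPair2 T[ P ] R[ P ])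
    × ((P Q : DyckPath n) → PairIso T[ P ] R[ P ] T[ Q ] R[ Q ] → proj₁ P ≡ proj₁ Q)
    × ((T R : Rel₂ n) → IsCatalanPair2 T R → ∃ λ (P : DyckPath n) → PairIso T[ P ] R[ P ] T R)
lemma2p8 n =
    (λ P → heightPair-isCatalanPair2 (height-mono P))
  , (λ P Q iso → height-ext P Q
      (heightPairIso⇒≗ (height-lower P) (height-upper P) (height-lower Q) (height-upper Q) iso))
  , FromCatalanPair.realisation
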